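{- Let $a\in\mathbb{R}$ with $1\leq a\leq 2$, let $k\in\mathbb{N}$ with $k\geq 2$ and let $G$ be a $C_{k+1}$-free digraph. Suppose $G$ contains a copy $C$ of $C_k$ with vertex set $A\subseteq V(G)$, and let $x\in V(G)\setminus A$. Then: (i) $e_a(A,\{x\})\leq k$; (ii) if $G[A,\{x\}]$ is neither an in-star nor an out-star, then $e_a(A,\{x\})\leq k-2+a$; (iii) if $G[A,\{x\}]$ is neither an in-star nor an out-star and contains no double edges, then $e_a(A,\{x\})\leq k-1$. Suppose moreover that for some $\ell\in\{k-1,k\}$, $G$ contains a copy $C'$ of $C_\ell$ with vertex set $A'\subseteq V(G)$, where $A\cap A'=\emptyset$. Then: (iv) $e_a(A,A')\leq k\ell$; (v) if $G[A,A']\notin\{\overrightarrow{K}(A,A'),\overrightarrow{K}(A',A)\}$, then $e_a(A,A')\leq k\ell-2+a$; (vi) if $G[A,A']\notin\{\overrightarrow{K}(A,A'),\overrightarrow{K}(A',A)\}$ and $G[A,A']$ contains no double edges, then $e_a(A,A')\leq k\ell-1$.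
   Context: Digraphs have no loops and may have edges in both directions between a pair (a double edge is a pair $u,v$ with both $uv$ and $vu$ edges). $C_k$ is the directed cycle on $k$ vertices. For a digraph $D$, $f_1(D)$ is the number of pairs joined by exactly one directed edge, $f_2(D)$ the number of pairs joined by a double edge, and $e_a(D):=af_2(D)+f_1(D)$. For disjoint $U,U'\subseteq V(G)$, $G[U,U']$ is the subdigraph with vertex set $U\cup U'$ consisting of all edges of $G$ between $U$ and $U'$ (in both directions), and $e_a(U,U'):=e_a(G[U,U'])$. $\overrightarrow{K}(U,U')$ is the oriented graph on $U\cup U'$ whose edges are all $|U||U'|$ edges directed from $U$ to $U'$. $G[A,\{x\}]$ is an in-star if $G[A,\{x\}]=\overrightarrow{K}(A,\{x\})$ and an out-star if $G[A,\{x\}]=\overrightarrow{K}(\{x\},A)$.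
   Formalization: The parameter $a$ ranges over the rationals with $1\leq a\leq 2$ instead of over the reals. -}

module Defs where

open import Data.Bool using (Bool; true; false)
open import Data.Nat using (ℕ; zero; suc)
open import Data.Fin using (Fin; toℕ)
import Data.Fin as Fin
open import Data.Integer using (+_)
open import Data.Rational using (ℚ; 0ℚ; 1ℚ; _+_; _/_)
open import Data.Product using (_×_)
open import Data.Sum using (_⊎_)
open import Function.Definitions using (Injective)
open import Relation.Binary.PropositionalEquality using (_≡_)

-- A finite digraph on vertex set Fin n: adjacency relation (u → v edge iff adj u v ≡ true),
-- no loops. Edges in both directions between a pair are allowed (double edges).
record Digraph : Set where
  field
    n        : ℕ
    adj      : Fin n → Fin n → Bool
    loopless : ∀ v → adj v v ≡ false

open Digraph public

ℕtoℚ : ℕ → ℚ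
ℕtoℚ m = + m / 1

-- Directed cycle C_k on vertex set Fin k: edge i → i+1 (mod k).
CycEdge : (k : ℕ) → Fin k → Fin k → Set
CycEdge k i j = (suc (toℕ i) ≡ toℕ j) ⊎ ((suc (toℕ i) ≡ k) × (toℕ j ≡ 0))

-- c : Fin k → V(G) is a copy of C_k in G (not necessarily induced):
-- c is injective and every edge of C_k is mapped to an edge of G.
IsCycleCopy : (k : ℕ) (G : Digraph) → (Fin k → Fin (n G)) → Set
IsCycleCopy k G c =
  Injective _≡_ _≡_ c × (∀ i j → CycEdge k i j → adj G (c i) (c j) ≡ true)

CycleFree : (k : ℕ) (G : Digraph) → Set
CycleFree k G = ∀ (c : Fin k → Fin (n G)) → IsCycleCopy k G c → Data.Empty.⊥
  where import Data.Empty

pairWeight : (a : ℚ) (G : Digraph) → Fin (n G) → Fin (n G) → ℚ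
pairWeight a G u v with adj G u v | adj G v u
... | true  | true  = a
... | true  | false = 1ℚ
... | false | true  = 1ℚ
... | false | false = 0ℚ

Σℚ : (k : ℕ) → (Fin k → ℚ) → ℚ
Σℚ zero    f = 0ℚ
Σℚ (suc k) f = f Fin.zero + Σℚ k (λ i → f (Fin.suc i))

-- e_a(A,{x}) where A = image of c
eaVertex : (a : ℚ) (G : Digraph) {k : ℕ} → (Fin k → Fin (n G)) → Fin (n G) → ℚ
eaVertex a G {k} c x = Σℚ k (λ i → pairWeight a G (c i) x)

-- e_a(A,A') where A = image of c, A' = image of c'
eaSets : (a : ℚ) (G : Digraph) {k ℓ : ℕ} → (Fin k → Fin (n G)) → (Fin ℓ → Fin (n G)) → ℚ
eaSets a G {k} {ℓ} c c' = Σℚ k (λ i → Σℚ ℓ (λ j → pairWeight a G (c i) (c' j)))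

IsCompleteFromTo : (G : Digraph) {k ℓ : ℕ} → (Fin k → Fin (n G)) → (Fin ℓ → Fin (n G)) → Set
IsCompleteFromTo G {k} {ℓ} c c' =
  ∀ i j → (adj G (c i) (c' j) ≡ true) × (adj G (c' j) (c i) ≡ false)

IsInStar : (G : Digraph) {k : ℕ} → (Fin k → Fin (n G)) → Fin (n G) → Set
IsInStar G c x = ∀ i → (adj G (c i) x ≡ true) × (adj G x (c i) ≡ false)

IsOutStar : (G : Digraph) {k : ℕ} → (Fin k → Fin (n G)) → Fin (n G) → Set
IsOutStar G c x = ∀ i → (adj G x (c i) ≡ true) × (adj G (c i) x ≡ false)

NoDoubleVertex : (G : Digraph) {k : ℕ} → (Fin k → Fin (n G)) → Fin (n G) → Set
NoDoubleVertex G c x = ∀ i → adj G (c i) x ≡ true → adj G x (c i) ≡ false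

NoDoubleSets : (G : Digraph) {k ℓ : ℕ} → (Fin k → Fin (n G)) → (Fin ℓ → Fin (n G)) → Set
NoDoubleSets G c c' = ∀ i j → adj G (c i) (c' j) ≡ true → adj G (c' j) (c i) ≡ false

{-# OPTIONS --safe #-}

-- Let the cycle be c₀ → c₁ → ⋯ → c_{k-1} → c₀ and write Iᵢ, Oᵢ for the arcs cᵢ → x and x → cᵢ.
-- Since G has no C_{k+1}, x cannot be inserted between consecutive cycle vertices, so Iᵢ and
-- O_{i+1} never both hold.  Pairing Iᵢ with O_{i+1} around the cycle, there are at most k arcs
-- between A and x, and e_a is at most the number of arcs because a ≤ 2, with a deficit of
-- 2 - a ≤ 1 at every double edge.  Without double edges, k arcs means that every pair
-- (Iᵢ, O_{i+1}) contributes an arc, and then ¬Iᵢ ⇒ O_{i+1} ⇒ ¬I_{i+1}, so G[A,{x}] is an in-star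
-- or an out-star.
-- For a second cycle c', e_a(A,A') = Σⱼ e_a(A,{c'ⱼ}).  An in-star c'ⱼ followed by an out-star
-- c'_{j+1} would give the (k+1)-cycle c'ⱼ → c'_{j+1} → c₀ → ⋯ → c_{k-2} → c'ⱼ, so if every c'ⱼ
-- is a star then all are in-stars or all are out-stars, i.e. G[A,A'] is complete one way.

module Submission where

open import Defs
open import Algebra.Bundles using (CommutativeMonoid)
open import Data.Bool using (Bool; true; false; _∨_)
open import Data.Bool.Properties using (¬-not) renaming (_≟_ to _≟ᵇ_)
open import Data.Empty using (⊥; ⊥-elim)
open import Data.Fin using (Fin; zero; suc; fromℕ; inject₁)
open import Data.Fin.Induction using (<-weakInduction; <-weakInduction-startingFrom)
open import Data.Fin.Properties
  using ( toℕ-injective; toℕ-inject₁; toℕ-fromℕ; toℕ<n; ≤fromℕ; inject₁-injective; suc-injective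
        ; all?; any?; ¬∀⟶∃¬ )
open import Data.Fin.Relation.Unary.Top using (view; ‵fromℕ; ‵inj₁; view-fromℕ; view-inject₁)
import Data.Integer as ℤ
import Data.Integer.Properties as ℤ
open import Data.Nat as ℕ using (ℕ; zero; suc; _≥_; _∸_; s≤s; z≤n)
import Data.Nat.Properties as ℕ
open import Data.Nat.Coprimality using (Coprime; 1-coprimeTo) renaming (sym to coprime-sym)
open import Data.Product using (∃; _×_; _,_; proj₁; proj₂)
open import Data.Rational using (ℚ; 0ℚ; 1ℚ; _+_; _-_; _*_; -_; _/_; mkℚ; _≤_; *≤*)
open import Data.Rational.Properties
open import Data.Rational.Solver using (module +-*-Solver)
open import Data.Sum using (_⊎_; inj₁; inj₂; [_,_])
import Data.Sum as Sum
open import Data.Vec.Functional using (_∷_; init)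
open import Function using (_∘_; id; case_of_; Injective)
import Function.Construct.Composition as Composition
open import Relation.Binary.PropositionalEquality
  using (_≡_; _≢_; refl; sym; trans; cong; cong₂; subst; subst₂; module ≡-Reasoning)
open import Relation.Nullary using (¬_; Dec; yes; no)
open import Relation.Nullary.Decidable using (_×-dec_; _⊎-dec_)
open import Relation.Unary using (Pred)

open import Algebra.Properties.CommutativeMonoid.Sum +-0-commutativeMonoid
  using (sum; ∑-distrib-+; ∑-comm; sum-init-last; sum-cong-≗)
open import Algebra.Properties.CommutativeSemigroup
  (CommutativeMonoid.commutativeSemigroup +-0-commutativeMonoid) using (xy∙z≈xz∙y)

ℕtoℚ-suc : ∀ m → ℕtoℚ (suc m) ≡ 1ℚ + ℕtoℚ m
ℕtoℚ-suc m = begin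
  ℕtoℚ (suc m)                      ≡⟨ cong (λ z → (ℤ.+ 1 ℤ.+ z) / 1) (ℤ.*-identityʳ (ℤ.+ m)) ⟨
  (ℤ.+ 1 ℤ.+ ℤ.+ m ℤ.* ℤ.+ 1) / 1  ≡⟨⟩
  1ℚ + mkℚ (ℤ.+ m) 0 m⊥1           ≡⟨ cong (1ℚ +_) (normalize-coprime m⊥1) ⟨
  1ℚ + ℕtoℚ m                       ∎
  where
  open ≡-Reasoning
  m⊥1 : Coprime m 1
  m⊥1 = coprime-sym (1-coprimeTo m)

p+r≤q⇒p≤q-r : ∀ {p q r} → p + r ≤ q → p ≤ q - r
p+r≤q⇒p≤q-r {p} {q} {r} p+r≤q = begin
  p          ≡⟨ solve 2 (λ p r → p := p :+ r :- r) refl p r ⟩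
  p + r - r  ≤⟨ +-monoˡ-≤ (- r) p+r≤q ⟩
  q - r      ∎
  where open ≤-Reasoning; open +-*-Solver

p+[2-a]≤q⇒p≤q-2+a : ∀ {p q a} → p + (ℕtoℚ 2 - a) ≤ q → p ≤ q - ℕtoℚ 2 + a
p+[2-a]≤q⇒p≤q-2+a {p} {q} {a} h =
  subst (p ≤_) (solve 3 (λ q t a → q :- (t :- a) := q :- t :+ a) refl q (ℕtoℚ 2) a) (p+r≤q⇒p≤q-r h)
  where open +-*-Solver

2-a≤1 : ∀ {a} → 1ℚ ≤ a → ℕtoℚ 2 - a ≤ 1ℚ
2-a≤1 1≤a = +-monoʳ-≤ (ℕtoℚ 2) (neg-antimono-≤ 1≤a)

Σℚ≡sum : ∀ k (f : Fin k → ℚ) → Σℚ k f ≡ sum f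
Σℚ≡sum zero    f = refl
Σℚ≡sum (suc k) f = cong (f zero +_) (Σℚ≡sum k (f ∘ suc))

Σℚ-cong : ∀ k {f g : Fin k → ℚ} → (∀ i → f i ≡ g i) → Σℚ k f ≡ Σℚ k g
Σℚ-cong zero    f≗g = refl
Σℚ-cong (suc k) f≗g = cong₂ _+_ (f≗g zero) (Σℚ-cong k (f≗g ∘ suc))

Σℚ-distrib-+ : ∀ k (f g : Fin k → ℚ) → Σℚ k (λ i → f i + g i) ≡ Σℚ k f + Σℚ k g
Σℚ-distrib-+ k f g = begin
  Σℚ k (λ i → f i + g i)  ≡⟨ Σℚ≡sum k _ ⟩
  sum (λ i → f i + g i)   ≡⟨ ∑-distrib-+ f g ⟩
  sum f + sum g           ≡⟨ cong₂ _+_ (Σℚ≡sum k f) (Σℚ≡sum k g) ⟨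
  Σℚ k f + Σℚ k g         ∎
  where open ≡-Reasoning

Σℚ-comm : ∀ k ℓ (f : Fin k → Fin ℓ → ℚ) →
          Σℚ k (λ i → Σℚ ℓ (f i)) ≡ Σℚ ℓ (λ j → Σℚ k (λ i → f i j))
Σℚ-comm k ℓ f = begin
  Σℚ k (λ i → Σℚ ℓ (f i))          ≡⟨ Σℚ≡sum² k ℓ f ⟩
  sum (λ i → sum (f i))            ≡⟨ ∑-comm f ⟩
  sum (λ j → sum (λ i → f i j))    ≡⟨ Σℚ≡sum² ℓ k (λ j i → f i j) ⟨
  Σℚ ℓ (λ j → Σℚ k (λ i → f i j))  ∎
  where
  open ≡-Reasoning
  Σℚ≡sum² : ∀ k ℓ (f : Fin k → Fin ℓ → ℚ) → Σℚ k (λ i → Σℚ ℓ (f i)) ≡ sum (λ i → sum (f i))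
  Σℚ≡sum² k ℓ f = trans (Σℚ≡sum k _) (sum-cong-≗ (λ i → Σℚ≡sum ℓ (f i)))

Σℚ-const : ∀ k q → Σℚ k (λ _ → q) ≡ q * ℕtoℚ k
Σℚ-const zero    q = sym (*-zeroʳ q)
Σℚ-const (suc k) q = begin
  q + Σℚ k (λ _ → q)   ≡⟨ cong (q +_) (Σℚ-const k q) ⟩
  q + q * ℕtoℚ k       ≡⟨ cong (_+ q * ℕtoℚ k) (*-identityʳ q) ⟨
  q * 1ℚ + q * ℕtoℚ k  ≡⟨ *-distribˡ-+ q 1ℚ (ℕtoℚ k) ⟨
  q * (1ℚ + ℕtoℚ k)    ≡⟨ cong (q *_) (ℕtoℚ-suc k) ⟨
  q * ℕtoℚ (suc k)     ∎
  where open ≡-Reasoning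

Σℚ-mono : ∀ k {f g : Fin k → ℚ} → (∀ i → f i ≤ g i) → Σℚ k f ≤ Σℚ k g
Σℚ-mono zero    f≤g = ≤-refl
Σℚ-mono (suc k) f≤g = +-mono-≤ (f≤g zero) (Σℚ-mono k (f≤g ∘ suc))

Σℚ-mono-gap : ∀ k {f g : Fin k → ℚ} {δ} → (∀ i → f i ≤ g i) →
              ∀ i → f i + δ ≤ g i → Σℚ k f + δ ≤ Σℚ k g
Σℚ-mono-gap (suc k) {f} {g} {δ} f≤g zero fδ≤g = begin
  f zero + Σℚ k (f ∘ suc) + δ  ≡⟨ xy∙z≈xz∙y (f zero) _ δ ⟩
  f zero + δ + Σℚ k (f ∘ suc)  ≤⟨ +-mono-≤ fδ≤g (Σℚ-mono k (f≤g ∘ suc)) ⟩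
  g zero + Σℚ k (g ∘ suc)      ∎
  where open ≤-Reasoning
Σℚ-mono-gap (suc k) {f} {g} {δ} f≤g (suc i) fδ≤g = begin
  f zero + Σℚ k (f ∘ suc) + δ    ≡⟨ +-assoc (f zero) _ δ ⟩
  f zero + (Σℚ k (f ∘ suc) + δ)  ≤⟨ +-mono-≤ (f≤g zero) (Σℚ-mono-gap k (f≤g ∘ suc) i fδ≤g) ⟩
  g zero + Σℚ k (g ∘ suc)        ∎
  where open ≤-Reasoning

next : ∀ {m} → Fin (suc m) → Fin (suc m)
next i with view i
... | ‵fromℕ          = zero
... | ‵inj₁ {i = j} _ = suc j

next-fromℕ : ∀ m → next (fromℕ m) ≡ zero
next-fromℕ m rewrite view-fromℕ m = refl

next-inject₁ : ∀ {m} (j : Fin m) → next (inject₁ j) ≡ suc j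
next-inject₁ j rewrite view-inject₁ j = refl

next-injective : ∀ {m} → Injective _≡_ _≡_ (next {m})
next-injective {x = i} {j} eq with view i | view j
... | ‵fromℕ  | ‵fromℕ  = refl
... | ‵fromℕ  | ‵inj₁ _ = case eq of λ ()
... | ‵inj₁ _ | ‵fromℕ  = case eq of λ ()
... | ‵inj₁ _ | ‵inj₁ _ = cong inject₁ (suc-injective eq)

cycEdge-next : ∀ {m} (i : Fin (suc m)) → CycEdge (suc m) i (next i)
cycEdge-next {m} i with view i
... | ‵fromℕ          = inj₂ (cong suc (toℕ-fromℕ m) , refl)
... | ‵inj₁ {i = j} _ = inj₁ (cong suc (toℕ-inject₁ j))

next-closed⇒all : ∀ {m p} (P : Pred (Fin (suc m)) p) → (∀ i → P i → P (next i)) →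
                  ∀ {j} → P j → ∀ i → P i
next-closed⇒all {m} P closed {j} Pⱼ = <-weakInduction P P₀ step
  where
  step : ∀ i → P (inject₁ i) → P (suc i)
  step i = subst P (next-inject₁ i) ∘ closed (inject₁ i)
  P₀ : P zero
  P₀ = subst P (next-fromℕ m) (closed (fromℕ m) (<-weakInduction-startingFrom P Pⱼ step (≤fromℕ j)))

next-closed-dichotomy : ∀ {m p q} (P : Pred (Fin (suc m)) p) (Q : Pred (Fin (suc m)) q) →
                        (∀ i → P i → P (next i)) → (∀ i → P i ⊎ Q i) → (∀ i → P i → Q i → ⊥) →
                        (∀ i → P i) ⊎ (∀ i → Q i)
next-closed-dichotomy P Q closed P⊎Q disjoint with P⊎Q zero
... | inj₁ P₀ = inj₁ (next-closed⇒all P closed P₀)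
... | inj₂ Q₀ = inj₂ λ i →
  [ (λ Pᵢ → ⊥-elim (disjoint zero (next-closed⇒all P closed Pᵢ zero) Q₀)) , id ] (P⊎Q i)

Σℚ-next : ∀ m (f : Fin (suc m) → ℚ) → Σℚ (suc m) (f ∘ next) ≡ Σℚ (suc m) f
Σℚ-next m f = begin
  Σℚ (suc m) (f ∘ next)                       ≡⟨ Σℚ≡sum (suc m) (f ∘ next) ⟩
  sum (f ∘ next)                              ≡⟨ sum-init-last (f ∘ next) ⟩
  sum (init (f ∘ next)) + f (next (fromℕ m))  ≡⟨ cong₂ _+_ (sum-cong-≗ (cong f ∘ next-inject₁))
                                                           (cong f (next-fromℕ m)) ⟩
  sum (f ∘ suc) + f zero                      ≡⟨ +-comm _ (f zero) ⟩
  f zero + sum (f ∘ suc)                      ≡⟨ Σℚ≡sum (suc m) f ⟨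
  Σℚ (suc m) f                                ∎
  where open ≡-Reasoning

∷-injective : ∀ {A : Set} {m x} {w : Fin m → A} →
              Injective _≡_ _≡_ w → (∀ i → w i ≢ x) → Injective _≡_ _≡_ (x ∷ w)
∷-injective w-inj x∉w {zero}  {zero}  _     = refl
∷-injective w-inj x∉w {zero}  {suc j} x≡wⱼ  = ⊥-elim (x∉w j (sym x≡wⱼ))
∷-injective w-inj x∉w {suc i} {zero}  wᵢ≡x  = ⊥-elim (x∉w i wᵢ≡x)
∷-injective w-inj x∉w {suc i} {suc j} wᵢ≡wⱼ = cong suc (w-inj wᵢ≡wⱼ)

IsWalk : (G : Digraph) {m : ℕ} → (Fin (suc m) → Fin (n G)) → Set
IsWalk G {m} w = ∀ (i : Fin m) → adj G (w (inject₁ i)) (w (suc i)) ≡ true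

module _ {G : Digraph} where

  IsWalk-∷ : ∀ {m x} {w : Fin (suc m) → Fin (n G)} →
             adj G x (w zero) ≡ true → IsWalk G w → IsWalk G (x ∷ w)
  IsWalk-∷ x→w₀ walk zero    = x→w₀
  IsWalk-∷ x→w₀ walk (suc i) = walk i

  IsWalk-init : ∀ {m} {w : Fin (suc (suc m)) → Fin (n G)} → IsWalk G w → IsWalk G (init w)
  IsWalk-init walk i = walk (inject₁ i)

  adj⇒≢ : ∀ {u v} → adj G u v ≡ true → u ≢ v
  adj⇒≢ {u} u→u refl = case trans (sym u→u) (loopless G u) of λ ()

  cycleCopy-next : ∀ {m c} → IsCycleCopy (suc m) G c → ∀ i → adj G (c i) (c (next i)) ≡ true
  cycleCopy-next (_ , edge) i = edge i (next i) (cycEdge-next i)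

  cycleCopy-walk : ∀ {m c} → IsCycleCopy (suc m) G c → IsWalk G c
  cycleCopy-walk (_ , edge) i = edge (inject₁ i) (suc i) (inj₁ (cong suc (toℕ-inject₁ i)))

  cycleCopy⁺ : ∀ {m c} → Injective _≡_ _≡_ c → IsWalk G c →
               adj G (c (fromℕ m)) (c zero) ≡ true → IsCycleCopy (suc m) G c
  cycleCopy⁺ {m} {c} c-inj walk closing = c-inj , edge
    where
    edge : ∀ i j → CycEdge (suc m) i j → adj G (c i) (c j) ≡ true
    edge i j (inj₁ 1+i≡j) with view i
    ... | ‵fromℕ = ⊥-elim (ℕ.<-irrefl (trans (sym 1+i≡j) (cong suc (toℕ-fromℕ m))) (toℕ<n j))
    ... | ‵inj₁ {i = i'} _ =
      subst (λ v → adj G (c (inject₁ i')) (c v) ≡ true)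
            (toℕ-injective (trans (cong suc (sym (toℕ-inject₁ i'))) 1+i≡j)) (walk i')
    edge i j (inj₂ (1+i≡1+m , j≡0)) =
      subst₂ (λ u v → adj G (c u) (c v) ≡ true)
             (toℕ-injective (trans (toℕ-fromℕ m) (sym (ℕ.suc-injective 1+i≡1+m))))
             (toℕ-injective {j = j} (sym j≡0)) closing

  cycleCopy-rotate : ∀ {m c} → IsCycleCopy (suc m) G c → IsCycleCopy (suc m) G (c ∘ next)
  cycleCopy-rotate {m} {c} copy@(c-inj , _) =
    cycleCopy⁺ (Composition.injective _≡_ _≡_ _≡_ next-injective c-inj) walk closing
    where
    walk : IsWalk G (c ∘ next)
    walk i = subst (λ v → adj G (c v) (c (next (suc i))) ≡ true) (sym (next-inject₁ i))
                   (cycleCopy-next copy (suc i))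
    closing : adj G (c (next (fromℕ m))) (c (next zero)) ≡ true
    closing = subst (λ v → adj G (c v) (c (next zero)) ≡ true) (sym (next-fromℕ m))
                    (cycleCopy-next copy zero)

  -- Inserting x after the last vertex gives the longer cycle x ∷ c; rotating c brings any
  -- position to the last one.
  no-insertion : ∀ {m} → CycleFree (suc (suc m)) G → ∀ {c x} → IsCycleCopy (suc m) G c → (∀ i → c i ≢ x) →
                 ∀ i → adj G (c i) x ≡ true → adj G x (c (next i)) ≡ false
  no-insertion {m} free {x = x} copy x∉c i cᵢ→x =
    ¬-not λ x→cᵢ₊₁ → next-closed⇒all Blocked blocked-next blocked-last i copy x∉c cᵢ→x x→cᵢ₊₁
    where
    Blocked : Fin (suc m) → Set
    Blocked i = ∀ {c} → IsCycleCopy (suc m) G c → (∀ j → c j ≢ x) →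
                adj G (c i) x ≡ true → adj G x (c (next i)) ≡ true → ⊥
    blocked-last : Blocked (fromℕ m)
    blocked-last {c} copy x∉c cₘ→x x→c₀ = free (x ∷ c) (cycleCopy⁺ (∷-injective (proj₁ copy) x∉c) walk cₘ→x)
      where
      walk : IsWalk G (x ∷ c)
      walk = IsWalk-∷ (subst (λ v → adj G x (c v) ≡ true) (next-fromℕ m) x→c₀) (cycleCopy-walk copy)
    blocked-next : ∀ i → Blocked i → Blocked (next i)
    blocked-next i blocked copy x∉c = blocked (cycleCopy-rotate copy) (x∉c ∘ next)

  -- The cycle y ∷ y' ∷ init c replaces the last vertex of c by the two vertices y → y'.
  no-detour : ∀ {m} → CycleFree (suc (suc (suc m))) G → ∀ {c y y'} → IsCycleCopy (suc (suc m)) G c →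
              (∀ i → c i ≢ y) → (∀ i → c i ≢ y') → adj G y y' ≡ true →
              adj G (c (inject₁ (fromℕ m))) y ≡ true → adj G y' (c zero) ≡ true → ⊥
  no-detour free {c} {y} {y'} copy@(c-inj , _) y∉c y'∉c y→y' c→y y'→c₀ =
    free (y ∷ y' ∷ init c) (cycleCopy⁺ (∷-injective (∷-injective init-inj (y'∉c ∘ inject₁)) y∉) walk c→y)
    where
    init-inj : Injective _≡_ _≡_ (init c)
    init-inj = Composition.injective _≡_ _≡_ _≡_ inject₁-injective c-inj
    y∉ : ∀ i → (y' ∷ init c) i ≢ y
    y∉ zero    = adj⇒≢ y→y' ∘ sym
    y∉ (suc i) = y∉c (inject₁ i)
    walk : IsWalk G (y ∷ y' ∷ init c)
    walk = IsWalk-∷ y→y' (IsWalk-∷ y'→c₀ (IsWalk-init {w = c} (cycleCopy-walk copy)))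

  stars⇒complete : ∀ {m ℓ} → CycleFree (suc (suc (suc m))) G → ∀ {c c'} →
                   IsCycleCopy (suc (suc m)) G c → IsCycleCopy ℓ G c' → (∀ i j → c i ≢ c' j) →
                   (∀ j → IsInStar G c (c' j) ⊎ IsOutStar G c (c' j)) →
                   IsCompleteFromTo G c c' ⊎ IsCompleteFromTo G c' c
  stars⇒complete {ℓ = zero}  _ _ _ _ _ = inj₁ λ _ ()
  stars⇒complete {m} {suc ℓ} free {c} {c'} copy copy' disjoint star =
    Sum.map (λ allIn i j → allIn j i) id (next-closed-dichotomy In Out In-next star In∩Out)
    where
    In Out : Fin (suc ℓ) → Set
    In  j = IsInStar G c (c' j)
    Out j = IsOutStar G c (c' j)
    In∩Out : ∀ j → In j → Out j → ⊥
    In∩Out j inⱼ outⱼ = case trans (sym (proj₁ (inⱼ zero))) (proj₂ (outⱼ zero)) of λ ()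
    In-next : ∀ j → In j → In (next j)
    In-next j inⱼ with star (next j)
    ... | inj₁ inⱼ₊₁  = inⱼ₊₁
    ... | inj₂ outⱼ₊₁ = ⊥-elim (no-detour free copy (λ i → disjoint i j) (λ i → disjoint i (next j))
                                          (cycleCopy-next copy' j) (proj₁ (inⱼ (inject₁ (fromℕ m))))
                                          (proj₁ (outⱼ₊₁ zero)))

star? : ∀ {G : Digraph} {k} (c : Fin k → Fin (n G)) x → Dec (IsInStar G c x ⊎ IsOutStar G c x)
star? {G} c x = all? (λ i → (adj G (c i) x ≟ᵇ true) ×-dec (adj G x (c i) ≟ᵇ false))
         ⊎-dec all? (λ i → (adj G x (c i) ≟ᵇ true) ×-dec (adj G (c i) x ≟ᵇ false))

bit : Bool → ℚ
bit true  = 1ℚ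
bit false = 0ℚ

bits≤1 : ∀ {p q} → (p ≡ true → q ≡ false) → bit p + bit q ≤ 1ℚ
bits≤1 {true}  {true}  p⇒¬q = case p⇒¬q refl of λ ()
bits≤1 {true}  {false} _    = ≤-refl
bits≤1 {false} {true}  _    = ≤-refl
bits≤1 {false} {false} _    = *≤* (ℤ.+≤+ z≤n)

bits-gap : ∀ {p q} → p ∨ q ≢ true → bit p + bit q + 1ℚ ≤ 1ℚ
bits-gap {true}          p∨q≢true = ⊥-elim (p∨q≢true refl)
bits-gap {false} {true}  p∨q≢true = ⊥-elim (p∨q≢true refl)
bits-gap {false} {false} _        = ≤-refl

module _ {m : ℕ} (I O : Fin (suc m) → Bool) where

  private
    Σones : Σℚ (suc m) (λ _ → 1ℚ) ≡ ℕtoℚ (suc m)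
    Σones = trans (Σℚ-const (suc m) 1ℚ) (*-identityˡ _)

  Σbits-shift : Σℚ (suc m) (λ i → bit (I i) + bit (O i)) ≡ Σℚ (suc m) (λ i → bit (I i) + bit (O (next i)))
  Σbits-shift = begin
    Σℚ (suc m) (λ i → bit (I i) + bit (O i))            ≡⟨ Σℚ-distrib-+ (suc m) (bit ∘ I) (bit ∘ O) ⟩
    Σℚ (suc m) (bit ∘ I) + Σℚ (suc m) (bit ∘ O)         ≡⟨ cong (Σℚ (suc m) (bit ∘ I) +_) (Σℚ-next m (bit ∘ O)) ⟨
    Σℚ (suc m) (bit ∘ I) + Σℚ (suc m) (bit ∘ O ∘ next)  ≡⟨ Σℚ-distrib-+ (suc m) (bit ∘ I) (bit ∘ O ∘ next) ⟨
    Σℚ (suc m) (λ i → bit (I i) + bit (O (next i)))     ∎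
    where open ≡-Reasoning

  cyclic-count≤ : (∀ i → I i ≡ true → O (next i) ≡ false) →
                  Σℚ (suc m) (λ i → bit (I i) + bit (O i)) ≤ ℕtoℚ (suc m)
  cyclic-count≤ I⇒¬O∘next = begin
    Σℚ (suc m) (λ i → bit (I i) + bit (O i))         ≡⟨ Σbits-shift ⟩
    Σℚ (suc m) (λ i → bit (I i) + bit (O (next i)))  ≤⟨ Σℚ-mono (suc m) (λ i → bits≤1 (I⇒¬O∘next i)) ⟩
    Σℚ (suc m) (λ _ → 1ℚ)                            ≡⟨ Σones ⟩
    ℕtoℚ (suc m)                                     ∎
    where open ≤-Reasoning

  cyclic-star : (∀ i → I i ≡ true → O i ≡ false) → (∀ i → I i ∨ O (next i) ≡ true) →
                (∀ i → I i ≡ true × O i ≡ false) ⊎ (∀ i → O i ≡ true × I i ≡ false)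
  cyclic-star I⇒¬O I∨O∘next =
    [ inj₂ ∘ outStar , inj₁ ∘ inStar ]
      (next-closed-dichotomy (λ i → I i ≡ false) (λ i → I i ≡ true) ¬I-next I? ¬I∩I)
    where
    I? : ∀ i → I i ≡ false ⊎ I i ≡ true
    I? i with I i
    ... | false = inj₁ refl
    ... | true  = inj₂ refl
    ¬I∩I : ∀ i → I i ≡ false → I i ≡ true → ⊥
    ¬I∩I i ¬Iᵢ Iᵢ = case trans (sym ¬Iᵢ) Iᵢ of λ ()
    O-next : ∀ i → I i ≡ false → O (next i) ≡ true
    O-next i ¬Iᵢ = subst (λ b → b ∨ O (next i) ≡ true) ¬Iᵢ (I∨O∘next i)
    ¬I-next : ∀ i → I i ≡ false → I (next i) ≡ false
    ¬I-next i ¬Iᵢ = ¬-not λ Iᵢ₊₁ → case trans (sym (O-next i ¬Iᵢ)) (I⇒¬O (next i) Iᵢ₊₁) of λ ()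
    inStar : (∀ i → I i ≡ true) → ∀ i → I i ≡ true × O i ≡ false
    inStar allI i = allI i , I⇒¬O i (allI i)
    outStar : (∀ i → I i ≡ false) → ∀ i → O i ≡ true × I i ≡ false
    outStar all¬I i =
      next-closed⇒all (λ i → O i ≡ true) (λ i _ → O-next i (all¬I i)) (O-next zero (all¬I zero)) i , all¬I i

  cyclic-count< : (∀ i → I i ≡ true → O (next i) ≡ false) → (∀ i → I i ≡ true → O i ≡ false) →
                  ¬ (∀ i → I i ≡ true × O i ≡ false) → ¬ (∀ i → O i ≡ true × I i ≡ false) →
                  Σℚ (suc m) (λ i → bit (I i) + bit (O i)) + 1ℚ ≤ ℕtoℚ (suc m)
  cyclic-count< I⇒¬O∘next I⇒¬O ¬in ¬out with all? (λ i → I i ∨ O (next i) ≟ᵇ true)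
  ... | yes noGap = ⊥-elim ([ ¬in , ¬out ] (cyclic-star I⇒¬O noGap))
  ... | no gap with ¬∀⟶∃¬ (suc m) _ (λ i → I i ∨ O (next i) ≟ᵇ true) gap
  ...   | i , gapᵢ = begin
    Σℚ (suc m) (λ i → bit (I i) + bit (O i)) + 1ℚ         ≡⟨ cong (_+ 1ℚ) Σbits-shift ⟩
    Σℚ (suc m) (λ i → bit (I i) + bit (O (next i))) + 1ℚ  ≤⟨ Σℚ-mono-gap (suc m) (λ i → bits≤1 (I⇒¬O∘next i))
                                                                        i (bits-gap {I i} gapᵢ) ⟩
    Σℚ (suc m) (λ _ → 1ℚ)                                 ≡⟨ Σones ⟩
    ℕtoℚ (suc m)                                          ∎
    where open ≤-Reasoning

arcs : (G : Digraph) → Fin (n G) → Fin (n G) → ℚ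
arcs G u v = bit (adj G u v) + bit (adj G v u)

pairWeight≤arcs : ∀ {a} → a ≤ ℕtoℚ 2 → ∀ G u v → pairWeight a G u v ≤ arcs G u v
pairWeight≤arcs a≤2 G u v with adj G u v | adj G v u
... | true  | true  = a≤2
... | true  | false = ≤-refl
... | false | true  = ≤-refl
... | false | false = ≤-refl

pairWeight-double : ∀ a G {u v} → adj G u v ≡ true → adj G v u ≡ true →
                    pairWeight a G u v + (ℕtoℚ 2 - a) ≤ arcs G u v
pairWeight-double a G {u} {v} u→v v→u with adj G u v | adj G v u
... | true  | true  = ≤-reflexive (solve 1 (λ a → a :+ (con (ℕtoℚ 2) :- a) := con (ℕtoℚ 2)) refl a)
  where open +-*-Solver
... | false | _     = case u→v of λ ()
... | true  | false = case v→u of λ ()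

pairWeight-single : ∀ a G {u v} → (adj G u v ≡ true → adj G v u ≡ false) → pairWeight a G u v ≡ arcs G u v
pairWeight-single a G {u} {v} u→v⇒¬v→u with adj G u v | adj G v u
... | true  | true  = case u→v⇒¬v→u refl of λ ()
... | true  | false = refl
... | false | true  = refl
... | false | false = refl

module CycleVertex {a : ℚ} (a≤2 : a ≤ ℕtoℚ 2) {m : ℕ} {G : Digraph} (free : CycleFree (suc (suc m)) G)
                   {c : Fin (suc m) → Fin (n G)} (copy : IsCycleCopy (suc m) G c)
                   {x : Fin (n G)} (x∉c : ∀ i → c i ≢ x) where

  private
    I O : Fin (suc m) → Bool
    I i = adj G (c i) x
    O i = adj G x (c i)

    no-insertion-at-x : ∀ i → I i ≡ true → O (next i) ≡ false
    no-insertion-at-x = no-insertion {G = G} free copy x∉c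

    arcs≤length : Σℚ (suc m) (λ i → arcs G (c i) x) ≤ ℕtoℚ (suc m)
    arcs≤length = cyclic-count≤ I O no-insertion-at-x

  eaVertex≤length : eaVertex a G c x ≤ ℕtoℚ (suc m)
  eaVertex≤length = ≤-trans (Σℚ-mono (suc m) (λ i → pairWeight≤arcs a≤2 G (c i) x)) arcs≤length

  eaVertex-nonStar-noDouble : ¬ IsInStar G c x → ¬ IsOutStar G c x → NoDoubleVertex G c x →
                              eaVertex a G c x + 1ℚ ≤ ℕtoℚ (suc m)
  eaVertex-nonStar-noDouble ¬in ¬out noDouble = begin
    eaVertex a G c x + 1ℚ                   ≡⟨ cong (_+ 1ℚ) (Σℚ-cong (suc m) (pairWeight-single a G ∘ noDouble)) ⟩
    Σℚ (suc m) (λ i → arcs G (c i) x) + 1ℚ  ≤⟨ cyclic-count< I O no-insertion-at-x noDouble ¬in ¬out ⟩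
    ℕtoℚ (suc m)                            ∎
    where open ≤-Reasoning

  eaVertex-nonStar : 1ℚ ≤ a → ¬ IsInStar G c x → ¬ IsOutStar G c x →
                     eaVertex a G c x + (ℕtoℚ 2 - a) ≤ ℕtoℚ (suc m)
  eaVertex-nonStar 1≤a ¬in ¬out with any? (λ i → (adj G (c i) x ≟ᵇ true) ×-dec (adj G x (c i) ≟ᵇ true))
  ... | yes (i , c→x , x→c) = begin
    eaVertex a G c x + (ℕtoℚ 2 - a)    ≤⟨ Σℚ-mono-gap (suc m) (λ i → pairWeight≤arcs a≤2 G (c i) x)
                                                       i (pairWeight-double a G c→x x→c) ⟩
    Σℚ (suc m) (λ i → arcs G (c i) x)  ≤⟨ arcs≤length ⟩
    ℕtoℚ (suc m)                       ∎
    where open ≤-Reasoning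
  ... | no noDouble = begin
    eaVertex a G c x + (ℕtoℚ 2 - a)  ≤⟨ +-monoʳ-≤ (eaVertex a G c x) (2-a≤1 1≤a) ⟩
    eaVertex a G c x + 1ℚ            ≤⟨ eaVertex-nonStar-noDouble ¬in ¬out
                                          (λ i c→x → ¬-not λ x→c → noDouble (i , c→x , x→c)) ⟩
    ℕtoℚ (suc m)                     ∎
    where open ≤-Reasoning

module CycleCycle {a : ℚ} (a≤2 : a ≤ ℕtoℚ 2) {m : ℕ} {G : Digraph} (free : CycleFree (suc (suc (suc m))) G)
                  {c : Fin (suc (suc m)) → Fin (n G)} (copy : IsCycleCopy (suc (suc m)) G c)
                  {ℓ : ℕ} {c' : Fin ℓ → Fin (n G)} (copy' : IsCycleCopy ℓ G c')
                  (disjoint : ∀ i j → c i ≢ c' j) where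

  private
    k : ℕ
    k = suc (suc m)

    module Vertex (j : Fin ℓ) = CycleVertex a≤2 {G = G} free copy (λ i → disjoint i j)

    eaSets≡Σ-eaVertex : eaSets a G c c' ≡ Σℚ ℓ (λ j → eaVertex a G c (c' j))
    eaSets≡Σ-eaVertex = Σℚ-comm k ℓ (λ i j → pairWeight a G (c i) (c' j))

    eaSets-gap : ∀ {δ} j → eaVertex a G c (c' j) + δ ≤ ℕtoℚ k → eaSets a G c c' + δ ≤ ℕtoℚ k * ℕtoℚ ℓ
    eaSets-gap {δ} j gapⱼ = begin
      eaSets a G c c' + δ                     ≡⟨ cong (_+ δ) eaSets≡Σ-eaVertex ⟩
      Σℚ ℓ (λ j → eaVertex a G c (c' j)) + δ  ≤⟨ Σℚ-mono-gap ℓ Vertex.eaVertex≤length j gapⱼ ⟩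
      Σℚ ℓ (λ _ → ℕtoℚ k)                     ≡⟨ Σℚ-const ℓ (ℕtoℚ k) ⟩
      ℕtoℚ k * ℕtoℚ ℓ                         ∎
      where open ≤-Reasoning

    nonStar : ¬ IsCompleteFromTo G c c' → ¬ IsCompleteFromTo G c' c →
              ∃ λ j → ¬ IsInStar G c (c' j) × ¬ IsOutStar G c (c' j)
    nonStar ¬c→c' ¬c'→c =
      let j , ¬star = ¬∀⟶∃¬ ℓ _ (λ j → star? {G} c (c' j))
                        ([ ¬c→c' , ¬c'→c ] ∘ stars⇒complete {G = G} free copy copy' disjoint)
      in j , ¬star ∘ inj₁ , ¬star ∘ inj₂

  eaSets≤k*ℓ : eaSets a G c c' ≤ ℕtoℚ k * ℕtoℚ ℓ
  eaSets≤k*ℓ = begin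
    eaSets a G c c'                     ≡⟨ eaSets≡Σ-eaVertex ⟩
    Σℚ ℓ (λ j → eaVertex a G c (c' j))  ≤⟨ Σℚ-mono ℓ Vertex.eaVertex≤length ⟩
    Σℚ ℓ (λ _ → ℕtoℚ k)                 ≡⟨ Σℚ-const ℓ (ℕtoℚ k) ⟩
    ℕtoℚ k * ℕtoℚ ℓ                     ∎
    where open ≤-Reasoning

  eaSets-nonComplete : 1ℚ ≤ a → ¬ IsCompleteFromTo G c c' → ¬ IsCompleteFromTo G c' c →
                       eaSets a G c c' + (ℕtoℚ 2 - a) ≤ ℕtoℚ k * ℕtoℚ ℓ
  eaSets-nonComplete 1≤a ¬c→c' ¬c'→c =
    let j , ¬in , ¬out = nonStar ¬c→c' ¬c'→c
    in eaSets-gap j (Vertex.eaVertex-nonStar j 1≤a ¬in ¬out)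

  eaSets-nonComplete-noDouble : ¬ IsCompleteFromTo G c c' → ¬ IsCompleteFromTo G c' c → NoDoubleSets G c c' →
                                eaSets a G c c' + 1ℚ ≤ ℕtoℚ k * ℕtoℚ ℓ
  eaSets-nonComplete-noDouble ¬c→c' ¬c'→c noDouble =
    let j , ¬in , ¬out = nonStar ¬c→c' ¬c'→c
    in eaSets-gap j (Vertex.eaVertex-nonStar-noDouble j ¬in ¬out (λ i → noDouble i j))

proposition6p1 :
    (a : ℚ) → 1ℚ ≤ a → a ≤ ℕtoℚ 2 →
    (k : ℕ) → k ≥ 2 →
    (G : Digraph) → CycleFree (suc k) G →
    (c : Fin k → Fin (n G)) → IsCycleCopy k G c →
    (x : Fin (n G)) → (∀ i → c i ≢ x) →
    ((eaVertex a G c x ≤ ℕtoℚ k)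
     × (¬ IsInStar G c x → ¬ IsOutStar G c x →
          eaVertex a G c x ≤ ℕtoℚ k - ℕtoℚ 2 + a)
     × (¬ IsInStar G c x → ¬ IsOutStar G c x → NoDoubleVertex G c x →
          eaVertex a G c x ≤ ℕtoℚ k - 1ℚ))
    ×
    ((ℓ : ℕ) → (ℓ ≡ k ∸ 1 ⊎ ℓ ≡ k) →
     (c' : Fin ℓ → Fin (n G)) → IsCycleCopy ℓ G c' →
     (∀ i j → c i ≢ c' j) →
     (eaSets a G c c' ≤ ℕtoℚ k * ℕtoℚ ℓ)
     × (¬ IsCompleteFromTo G c c' → ¬ IsCompleteFromTo G c' c →
          eaSets a G c c' ≤ ℕtoℚ k * ℕtoℚ ℓ - ℕtoℚ 2 + a)
     × (¬ IsCompleteFromTo G c c' → ¬ IsCompleteFromTo G c' c → NoDoubleSets G c c' →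
          eaSets a G c c' ≤ ℕtoℚ k * ℕtoℚ ℓ - 1ℚ))
proposition6p1 a 1≤a a≤2 .(suc (suc m)) (s≤s (s≤s (z≤n {m}))) G free c copy x x∉c =
  ( eaVertex≤length
  , (λ ¬in ¬out → p+[2-a]≤q⇒p≤q-2+a (eaVertex-nonStar 1≤a ¬in ¬out))
  , (λ ¬in ¬out noDouble → p+r≤q⇒p≤q-r (eaVertex-nonStar-noDouble ¬in ¬out noDouble)) )
  , λ ℓ _ c' copy' disjoint → let open CycleCycle a≤2 {G = G} free copy copy' disjoint in
    ( eaSets≤k*ℓ
    , (λ ¬c→c' ¬c'→c → p+[2-a]≤q⇒p≤q-2+a (eaSets-nonComplete 1≤a ¬c→c' ¬c'→c))
    , (λ ¬c→c' ¬c'→c noDouble → p+r≤q⇒p≤q-r (eaSets-nonComplete-noDouble ¬c→c' ¬c'→c noDouble)) )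
  where open CycleVertex a≤2 {G = G} free copy x∉c
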